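{- If $G$ is a graph with property $(*)$ and $G$ is not a single edge, then no edge of $G$ has the same face (finite or infinite) on both sides.
   Context: Property $(*)$: $G$ is a finite connected bipartite plane graph with fixed proper black/white vertex coloring such that every edge of $G$ lies in some perfect matching of $G$. -}

module Defs where

-- Plane graphs are encoded as combinatorial maps (rotation systems) of
-- genus 0.  Darts (half-edges) are Fin d; α pairs the two darts of an edge,
-- σ is the cyclic rotation of darts around each vertex, and the faces are
-- the orbits of φ = σ ∘ α (face tracing).  Vertices and faces are given by
-- explicit surjective labelings whose fibres are exactly the σ-orbits and
-- φ-orbits respectively, so that n = #vertices and f = #faces, and
-- planarity is Euler's formula  n - e + f = 2  with e = d / 2.

open import Data.Nat using (ℕ; zero; suc; _+_; _*_)
open import Data.Fin using (Fin)
open import Data.Fin.Permutation using (Permutation′; _⟨$⟩ʳ_; _∘ₚ_)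
open import Data.Bool using (Bool; true; false)
open import Data.Product using (Σ; ∃; _×_; _,_)
open import Relation.Binary.PropositionalEquality using (_≡_; _≢_)
open import Relation.Binary.Construct.Closure.ReflexiveTransitive using (Star)
open import Data.Sum using (_⊎_)
open import Function.Bundles using (_⇔_)

iter : {A : Set} → (A → A) → ℕ → A → A
iter g zero    x = x
iter g (suc k) x = g (iter g k x)

SameOrbit : {d : ℕ} → Permutation′ d → Fin d → Fin d → Set
SameOrbit π x y = ∃ λ k → iter (π ⟨$⟩ʳ_) k x ≡ y

data MapStep {d : ℕ} (α σ : Permutation′ d) : Fin d → Fin d → Set where
  viaα : ∀ x → MapStep α σ x (α ⟨$⟩ʳ x)
  viaσ : ∀ x → MapStep α σ x (σ ⟨$⟩ʳ x)

record PlaneGraph : Set where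
  field
    d        : ℕ
    α        : Permutation′ d
    σ        : Permutation′ d
    α-invol  : ∀ x → α ⟨$⟩ʳ (α ⟨$⟩ʳ x) ≡ x
    α-free   : ∀ x → α ⟨$⟩ʳ x ≢ x
    n        : ℕ
    vert     : Fin d → Fin n
    vert-surj : ∀ v → ∃ λ x → vert x ≡ v
    vert-orb : ∀ x y → (vert x ≡ vert y) ⇔ SameOrbit σ x y
    f        : ℕ
    face     : Fin d → Fin f
    face-surj : ∀ g → ∃ λ x → face x ≡ g
    face-orb : ∀ x y → (face x ≡ face y) ⇔ SameOrbit (α ∘ₚ σ) x y  -- (α ∘ₚ σ) x = σ (α x)
    connected : ∀ x y → Star (MapStep α σ) x y
    -- planarity (genus 0): 2(n + f) = 4 + d, i.e. n - e + f = 2 with d = 2e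
    euler    : 2 * (n + f) ≡ 4 + d

open PlaneGraph public

ProperColouring : PlaneGraph → Set
ProperColouring G = Σ (Fin (n G) → Bool) λ col →
  ∀ x → col (vert G (α G ⟨$⟩ʳ x)) ≢ col (vert G x)

-- a perfect matching: a set of edges (α-closed set of darts) such that
-- every vertex is incident to exactly one dart of the set
record PerfectMatching (G : PlaneGraph) : Set where
  field
    M        : Fin (d G) → Bool
    M-edge   : ∀ x → M (α G ⟨$⟩ʳ x) ≡ M x
    M-cover  : ∀ v → ∃ λ x → vert G x ≡ v × M x ≡ true
    M-unique : ∀ x y → vert G x ≡ vert G y → M x ≡ true → M y ≡ true → x ≡ y
open PerfectMatching public

-- Property (*): connected (built into PlaneGraph) bipartite plane graph with a
-- fixed proper colouring such that every edge lies in some perfect matching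
Property* : PlaneGraph → Set
Property* G = ProperColouring G × (∀ x → Σ (PerfectMatching G) λ P → M P x ≡ true)

-- G is a single edge (one edge, hence two darts; with connectivity and
-- no loops this is exactly K₂)
SingleEdge : PlaneGraph → Set
SingleEdge G = d G ≡ 2

-- Let the edge e of the dart x have the same face on both sides.  Deleting e, i.e. making x
-- and α x fixed points of the edge involution, splits that face into two.  Since every edge
-- lies in a perfect matching and G is not K₂, there are perfect matchings P ∋ e and Q ∌ e
-- with Q covering an end of e by another edge; the alternating P/Q cycle through e then joins
-- the ends of e without using e, so G − e stays connected.  Euler's inequality
--   #σ-orbits + #h-orbits + #(σ ∘ h)-orbits ≤ #darts + 2 · #components
-- holds for every permutation σ and involution h of the darts: build h from the identity by
-- inserting its 2-cycles one at a time; each insertion removes one h-orbit, splits or merges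
-- one (σ ∘ h)-orbit, and merges two components only when it merges two (σ ∘ h)-orbits.
-- If G has n vertices, E edges and f faces, for G − e it reads
-- n + (E + 1) + (f + 1) ≤ 2E + 2, contradicting Euler's formula n − E + f = 2.

module Submission where

open import Defs
open import Data.Bool using (true; not)
open import Data.Bool.Properties using (¬-not; not-¬; not-involutive)
open import Data.Empty using (⊥; ⊥-elim)
open import Data.Fin using (Fin; zero; suc; toℕ; combine; punchIn; punchOut; _≟_)
open import Data.Fin.Properties
  using (¬Fin0; any?; pigeonhole; injective⇒≤; suc-injective; toℕ-injective; combine-injective;
         punchOut-cong; punchOut-injective; punchOut-punchIn; punchInᵢ≢i)
open import Data.Fin.Permutation using (_⟨$⟩ʳ_)
open import Data.Fin.Permutation.Components using (transpose)
open import Data.List using (List; []; _∷_; allFin)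
open import Data.List.Membership.Propositional using (_∈_)
open import Data.List.Membership.Propositional.Properties using (∈-allFin)
open import Data.List.Relation.Unary.Any using (here; there)
open import Data.Nat using (ℕ; zero; suc; _+_; _*_; _∸_; _≤_; _<_; z≤n; s≤s)
open import Data.Nat.Tactic.RingSolver using (solve-∀)
open import Data.Nat.DivMod using (_%_; _/_; m≡m%n+[m/n]*n; m%n<n)
open import Data.Nat.Properties
  using (n<1+n; +-cancelˡ-≤; m+1+n≰m; module ≤-Reasoning; ≤-reflexive; *-monoʳ-≤; n≤1+n; ≤-trans; +-monoʳ-≤; <-asym; ≮⇒≥; _<?_;
         m∸n≤m; m∸n+n≡m; ≤-refl; m≤n⇒m<n∨m≡n; <-≤-trans; ≤-pred; m+[n∸m]≡n; +-suc; +-comm; ≤-antisym; anyUpTo?)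
open import Data.Product using (∃; _×_; _,_; proj₁; proj₂; swap)
open import Data.Sum using (_⊎_; inj₁; inj₂)
open import Function using (_∘_; id; _on_)
open import Algebra.Definitions using (Involutive)
open import Function.Bundles using (Equivalence; Injection)
import Function.Bundles as Fun using (_⇔_)
open import Function.Definitions using (Injective)
open import Function.Properties.Inverse using (↔⇒↣)
open import Level using (0ℓ)
open import Relation.Binary.Core using (Rel; _⇒_; _⇔_)
open import Relation.Binary.Definitions using (Decidable)
open import Relation.Binary.Structures using (IsEquivalence)
import Relation.Binary.Construct.On as On
open import Relation.Binary.Construct.Closure.Equivalence as EqClosure using (EqClosure)
open import Relation.Binary.Construct.Closure.ReflexiveTransitive as Star using (Star; ε; _◅_; _◅◅_)
open import Relation.Binary.Construct.Closure.Symmetric using (fwd; bwd)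
open import Relation.Binary.Construct.Union using (_∪_)
open import Relation.Binary.PropositionalEquality
open import Relation.Nullary using (¬_; Dec; yes; no)
open import Relation.Nullary.Decidable using (map′)

private
  variable
    m c c′ : ℕ

Endo : ℕ → Set
Endo m = Fin m → Fin m

involutive⇒injective : ∀ {g : Endo m} → Involutive _≡_ g → Injective _≡_ _≡_ g
involutive⇒injective {g = g} g-invol {x} {y} gx≡gy = begin
  x       ≡⟨ g-invol x ⟨
  g (g x) ≡⟨ cong g gx≡gy ⟩
  g (g y) ≡⟨ g-invol y ⟩
  y       ∎
  where open ≡-Reasoning

-- Transpositions

data TransposeView {m} (i j : Fin m) : Fin m → Set where
  at-i  : TransposeView i j i
  at-j  : j ≢ i → TransposeView i j j
  apart : ∀ {k} → k ≢ i → k ≢ j → TransposeView i j k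

transposeView : (i j k : Fin m) → TransposeView i j k
transposeView i j k with k ≟ i | k ≟ j
... | yes refl | _        = at-i
... | no k≢i   | yes refl = at-j k≢i
... | no k≢i   | no k≢j   = apart k≢i k≢j

transpose-matchˡ : (i j : Fin m) → transpose i j i ≡ j
transpose-matchˡ i j with i ≟ i
... | yes _   = refl
... | no i≢i = ⊥-elim (i≢i refl)

transpose-matchʳ : (i j : Fin m) → transpose i j j ≡ i
transpose-matchʳ i j with j ≟ i
... | yes j≡i = j≡i
... | no _ with j ≟ j
...   | yes _   = refl
...   | no j≢j = ⊥-elim (j≢j refl)

transpose-other : {i j k : Fin m} → k ≢ i → k ≢ j → transpose i j k ≡ k
transpose-other {i = i} {j} {k} k≢i k≢j with k ≟ i
... | yes k≡i = ⊥-elim (k≢i k≡i)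
... | no _ with k ≟ j
...   | yes k≡j = ⊥-elim (k≢j k≡j)
...   | no _    = refl

transpose-involutive : (i j k : Fin m) → transpose i j (transpose i j k) ≡ k
transpose-involutive i j k with transposeView i j k
... | at-i        = trans (cong (transpose i j) (transpose-matchˡ i j)) (transpose-matchʳ i j)
... | at-j _      = trans (cong (transpose i j) (transpose-matchʳ i j)) (transpose-matchˡ i j)
... | apart k≢i k≢j = trans (cong (transpose i j) (transpose-other k≢i k≢j)) (transpose-other k≢i k≢j)

transpose-injective : (i j : Fin m) → Injective _≡_ _≡_ (transpose i j)
transpose-injective i j = involutive⇒injective {g = transpose i j} (transpose-involutive i j)

-- Iterates and orbits

module _ {g : Endo m} where

  iter-+ : ∀ k l x → iter g (k + l) x ≡ iter g k (iter g l x)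
  iter-+ zero    l x = refl
  iter-+ (suc k) l x = cong g (iter-+ k l x)

  iter-fixed : ∀ {a} → g a ≡ a → ∀ k → iter g k a ≡ a
  iter-fixed ga≡a zero    = refl
  iter-fixed ga≡a (suc k) = trans (cong g (iter-fixed ga≡a k)) ga≡a

  iter-periodic : ∀ {p x} → iter g p x ≡ x → ∀ q → iter g (q * p) x ≡ x
  iter-periodic               period zero    = refl
  iter-periodic {p = p} {x} period (suc q) = begin
    iter g (p + q * p) x     ≡⟨ iter-+ p (q * p) x ⟩
    iter g p (iter g (q * p) x) ≡⟨ cong (iter g p) (iter-periodic period q) ⟩
    iter g p x               ≡⟨ period ⟩
    x                        ∎
    where open ≡-Reasoning

  iter-mod : ∀ {p x} → iter g (suc p) x ≡ x → ∀ k → iter g (k % suc p) x ≡ iter g k x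
  iter-mod {p} {x} period k = sym (begin
    iter g k x                                 ≡⟨ cong (λ l → iter g l x) (m≡m%n+[m/n]*n k (suc p)) ⟩
    iter g (k % suc p + k / suc p * suc p) x   ≡⟨ iter-+ (k % suc p) (k / suc p * suc p) x ⟩
    iter g (k % suc p) (iter g (k / suc p * suc p) x)
      ≡⟨ cong (iter g (k % suc p)) (iter-periodic period (k / suc p)) ⟩
    iter g (k % suc p) x                       ∎)
    where open ≡-Reasoning

  module _ (g-inj : Injective _≡_ _≡_ g) where

    iter-injective : ∀ k → Injective _≡_ _≡_ (iter g k)
    iter-injective zero    e = e
    iter-injective (suc k) e = iter-injective k (g-inj e)

    iter-period : ∀ x → ∃ λ p → iter g (suc p) x ≡ x
    iter-period x with pigeonhole (n<1+n m) (λ i → iter g (toℕ i) x)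
    ... | i , j , i<j , gⁱx≡gʲx = p , iter-injective (toℕ i) (begin
      iter g (toℕ i) (iter g (suc p) x) ≡⟨ iter-+ (toℕ i) (suc p) x ⟨
      iter g (toℕ i + suc p) x           ≡⟨ cong (λ k → iter g k x) (trans (+-suc (toℕ i) p) (m+[n∸m]≡n i<j)) ⟩
      iter g (toℕ j) x                   ≡⟨ gⁱx≡gʲx ⟨
      iter g (toℕ i) x                   ∎)
      where
      open ≡-Reasoning
      p = toℕ j ∸ suc (toℕ i)

Step : Endo m → Rel (Fin m) 0ℓ
Step g x y = g x ≡ y

Orbit : Endo m → Rel (Fin m) 0ℓ
Orbit g = EqClosure (Step g)

Reaches : Endo m → Rel (Fin m) 0ℓ
Reaches g x y = ∃ λ k → iter g k x ≡ y

single : ∀ {R : Rel (Fin m) 0ℓ} {x y} → R x y → EqClosure R x y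
single r = fwd r ◅ ε

_⋆ : ∀ {R S : Rel (Fin m) 0ℓ} → R ⇒ EqClosure S → EqClosure R ⇒ EqClosure S
_⋆ {S = S} = EqClosure.fold (EqClosure.isEquivalence S)

EqClosure-resp : ∀ {R S : Rel (Fin m) 0ℓ} → R ⇒ EqClosure S → S ⇒ EqClosure R → EqClosure R ⇔ EqClosure S
EqClosure-resp R⇒S S⇒R = R⇒S ⋆ , S⇒R ⋆

Orbit-resp-≗ : {g h : Endo m} → g ≗ h → Orbit g ⇒ Orbit h
Orbit-resp-≗ g≗h = (λ {x} gx≡y → single (trans (sym (g≗h x)) gx≡y)) ⋆

module _ {g : Endo m} where

  reaches⇒orbit : ∀ {x y} → Reaches g x y → Orbit g x y
  reaches⇒orbit (zero  , refl) = ε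
  reaches⇒orbit (suc k , refl) = reaches⇒orbit (k , refl) ◅◅ single refl

  reaches-trans : ∀ {x y z} → Reaches g x y → Reaches g y z → Reaches g x z
  reaches-trans {x} (k , refl) (l , refl) = l + k , iter-+ l k x

  module _ (g-inj : Injective _≡_ _≡_ g) where

    reaches-back : ∀ x → Reaches g (g x) x
    reaches-back x with iter-period g-inj x
    ... | p , period = p , (begin
      iter g p (iter g 1 x) ≡⟨ iter-+ p 1 x ⟨
      iter g (p + 1) x      ≡⟨ cong (λ k → iter g k x) (+-comm p 1) ⟩
      iter g (suc p) x      ≡⟨ period ⟩
      x                     ∎)
      where open ≡-Reasoning

    orbit⇒reaches : ∀ {x y} → Orbit g x y → Reaches g x y
    orbit⇒reaches ε                = 0 , refl
    orbit⇒reaches (fwd refl ◅ x~y) = reaches-trans (1 , refl) (orbit⇒reaches x~y)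
    orbit⇒reaches (bwd refl ◅ x~y) = reaches-trans (reaches-back _) (orbit⇒reaches x~y)

    reaches? : Decidable (Reaches g)
    reaches? x y with iter-period g-inj x
    ... | p , period = map′ (λ (k , _ , gᵏx≡y) → k , gᵏx≡y) reduce (anyUpTo? (λ k → iter g k x ≟ y) (suc p))
      where
      reduce : Reaches g x y → ∃ λ k → k < suc p × iter g k x ≡ y
      reduce (k , gᵏx≡y) = k % suc p , m%n<n k (suc p) , trans (iter-mod period k) gᵏx≡y

    orbit? : Decidable (Orbit g)
    orbit? x y = map′ reaches⇒orbit orbit⇒reaches (reaches? x y)

    orbit-of-fixed : ∀ {a x} → g a ≡ a → Orbit g a x → x ≡ a
    orbit-of-fixed ga≡a a~x with orbit⇒reaches a~x
    ... | k , refl = iter-fixed ga≡a k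

-- Counting equivalence classes

record Labelling {m} (R : Rel (Fin m) 0ℓ) (c : ℕ) : Set where
  field
    label      : Fin m → Fin c
    reflects   : ∀ x y → label x ≡ label y → R x y
    respects   : ∀ {x y} → R x y → label x ≡ label y
    surjective : ∀ i → ∃ λ x → label x ≡ i
open Labelling public

module _ {R : Rel (Fin m) 0ℓ} where

  Labelling-≤ : Labelling R c → Labelling R c′ → c ≤ c′
  Labelling-≤ L L′ = injective⇒≤ {f = label L′ ∘ representative} representative-injective
    where
    representative = λ i → proj₁ (surjective L i)
    representative-injective : Injective _≡_ _≡_ (label L′ ∘ representative)
    representative-injective {i} {j} e = begin
      i                          ≡⟨ proj₂ (surjective L i) ⟨
      label L (representative i) ≡⟨ respects L (reflects L′ _ _ e) ⟩
      label L (representative j) ≡⟨ proj₂ (surjective L j) ⟩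
      j                          ∎
      where open ≡-Reasoning

  labelling-unique : Labelling R c → Labelling R c′ → c ≡ c′
  labelling-unique L L′ = ≤-antisym (Labelling-≤ L L′) (Labelling-≤ L′ L)

  Labelling-resp : ∀ {S} → R ⇔ S → Labelling R c → Labelling S c
  Labelling-resp (R⇒S , S⇒R) L = record
    { label = label L ; reflects = λ x y e → R⇒S (reflects L x y e)
    ; respects = respects L ∘ S⇒R ; surjective = surjective L }

Labelling-total : ∀ {R : Rel (Fin m) 0ℓ} → (∀ a b → R a b) → Fin m → Labelling R 1
Labelling-total total x = record
  { label = λ _ → zero ; reflects = λ a b _ → total a b
  ; respects = λ _ → refl ; surjective = λ where zero → x , refl }

module _ {R : Rel (Fin (suc m)) 0ℓ} (R-equiv : IsEquivalence R) where
  open IsEquivalence R-equiv renaming (refl to R-refl; sym to R-sym; trans to R-trans)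

  Labelling-cons-joined : ∀ {y₀} → R zero (suc y₀) → Labelling (R on suc) c → Labelling R c
  Labelling-cons-joined {y₀ = y₀} 0~y₀ L = record
    { label = label′ ; reflects = reflects′ ; respects = respects′
    ; surjective = λ i → suc (proj₁ (surjective L i)) , proj₂ (surjective L i) }
    where
    label′ : Fin (suc m) → Fin _
    label′ zero    = label L y₀
    label′ (suc x) = label L x
    reflects′ : ∀ x y → label′ x ≡ label′ y → R x y
    reflects′ zero    zero    _ = R-refl
    reflects′ zero    (suc y) e = R-trans 0~y₀ (reflects L _ _ e)
    reflects′ (suc x) zero    e = R-sym (R-trans 0~y₀ (reflects L _ _ (sym e)))
    reflects′ (suc x) (suc y) e = reflects L _ _ e
    respects′ : ∀ {x y} → R x y → label′ x ≡ label′ y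
    respects′ {zero}  {zero}  _ = refl
    respects′ {zero}  {suc y} r = respects L (R-trans (R-sym 0~y₀) r)
    respects′ {suc x} {zero}  r = sym (respects L (R-trans (R-sym 0~y₀) (R-sym r)))
    respects′ {suc x} {suc y} r = respects L r

  Labelling-cons-fresh : (∀ y → ¬ R zero (suc y)) → Labelling (R on suc) c → Labelling R (suc c)
  Labelling-cons-fresh 0≁ L = record
    { label = label′ ; reflects = reflects′ ; respects = respects′ ; surjective = surjective′ }
    where
    label′ : Fin (suc m) → Fin (suc _)
    label′ zero    = zero
    label′ (suc x) = suc (label L x)
    reflects′ : ∀ x y → label′ x ≡ label′ y → R x y
    reflects′ zero    zero    _ = R-refl
    reflects′ (suc x) (suc y) e = reflects L _ _ (suc-injective e)
    respects′ : ∀ {x y} → R x y → label′ x ≡ label′ y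
    respects′ {zero}  {zero}  _ = refl
    respects′ {zero}  {suc y} r = ⊥-elim (0≁ y r)
    respects′ {suc x} {zero}  r = ⊥-elim (0≁ x (R-sym r))
    respects′ {suc x} {suc y} r = cong suc (respects L r)
    surjective′ : ∀ i → ∃ λ x → label′ x ≡ i
    surjective′ zero    = zero , refl
    surjective′ (suc i) = suc (proj₁ (surjective L i)) , cong suc (proj₂ (surjective L i))

labelling : ∀ {m} {R : Rel (Fin m) 0ℓ} → IsEquivalence R → Decidable R → ∃ (Labelling R)
labelling {zero} _ _ = 0 , record
  { label = λ () ; reflects = λ () ; respects = λ {x} → ⊥-elim (¬Fin0 x) ; surjective = λ () }
labelling {suc m} {R} R-equiv R? with labelling (On.isEquivalence suc R-equiv) (λ x y → R? (suc x) (suc y))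
... | c , L with any? (λ y → R? zero (suc y))
...   | yes (y₀ , 0~y₀) = c , Labelling-cons-joined R-equiv 0~y₀ L
...   | no 0≁          = suc c , Labelling-cons-fresh R-equiv (λ y r → 0≁ (y , r)) L

orbitLabelling : ∀ {g : Endo m} → Injective _≡_ _≡_ g → ∃ (Labelling (Orbit g))
orbitLabelling g-inj = labelling (EqClosure.isEquivalence _) (orbit? g-inj)

id-orbits : Labelling (Orbit {m} id) m
id-orbits = record
  { label = id ; reflects = λ x y x≡y → subst (Orbit id x) x≡y ε
  ; respects = EqClosure.gfold isEquivalence id id ; surjective = λ i → i , refl }

module _ {g : Endo m} (g-invol : Involutive _≡_ g) where

  iter-involution : ∀ k x → iter g k x ≡ x ⊎ iter g k x ≡ g x
  iter-involution zero    x = inj₁ refl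
  iter-involution (suc k) x with iter-involution k x
  ... | inj₁ gᵏx≡x  = inj₂ (cong g gᵏx≡x)
  ... | inj₂ gᵏx≡gx = inj₁ (trans (cong g gᵏx≡gx) (g-invol x))

  involution-orbit : ∀ {x y} → Orbit g x y → y ≡ x ⊎ y ≡ g x
  involution-orbit x~y with orbit⇒reaches (involutive⇒injective g-invol) x~y
  ... | k , refl = iter-involution k _

  involution-orbits : Labelling (Orbit g) c → m ≤ 2 * c
  involution-orbits {c} L = injective⇒≤ encode-injective
    where
    -- The at most two points x, g x of an orbit are told apart by whether x < g x.
    side : Fin m → Fin 2
    side x with toℕ x <? toℕ (g x)
    ... | yes _ = zero
    ... | no _  = suc zero

    side-separates : ∀ x → side x ≡ side (g x) → x ≡ g x
    side-separates x e with toℕ x <? toℕ (g x) | toℕ (g x) <? toℕ (g (g x))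
    ... | yes x<gx | yes gx<ggx = ⊥-elim (<-asym x<gx (subst (λ z → toℕ (g x) < toℕ z) (g-invol x) gx<ggx))
    ... | no x≮gx  | no gx≮ggx  =
      toℕ-injective (≤-antisym (subst (λ z → toℕ z ≤ toℕ (g x)) (g-invol x) (≮⇒≥ gx≮ggx)) (≮⇒≥ x≮gx))
    side-separates x () | yes _ | no _
    side-separates x () | no _  | yes _

    encode : Fin m → Fin (2 * c)
    encode x = combine (side x) (label L x)

    encode-injective : Injective _≡_ _≡_ encode
    encode-injective {x} {y} e with combine-injective (side x) (label L x) (side y) (label L y) e
    ... | sx≡sy , lx≡ly with involution-orbit (reflects L x y lx≡ly)
    ...   | inj₁ y≡x  = sym y≡x
    ...   | inj₂ refl = side-separates x sx≡sy

module _ (i j : Fin (suc c)) (i≢j : i ≢ j) where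

  identify : Fin (suc c) → Fin c
  identify k with j ≟ k
  ... | yes _   = punchOut (i≢j ∘ sym)
  ... | no j≢k = punchOut j≢k

  identify-identifies : identify i ≡ identify j
  identify-identifies with j ≟ i | j ≟ j
  ... | yes j≡i | _       = ⊥-elim (i≢j (sym j≡i))
  ... | no _    | yes _   = punchOut-cong j refl
  ... | no _    | no j≢j = ⊥-elim (j≢j refl)

  identify-kernel : ∀ k l → identify k ≡ identify l → k ≡ l ⊎ (k ≡ i × l ≡ j) ⊎ (k ≡ j × l ≡ i)
  identify-kernel k l e with j ≟ k | j ≟ l
  ... | yes j≡k | yes j≡l = inj₁ (trans (sym j≡k) j≡l)
  ... | yes j≡k | no j≢l  = inj₂ (inj₂ (sym j≡k , sym (punchOut-injective (i≢j ∘ sym) j≢l e)))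
  ... | no j≢k  | yes j≡l = inj₂ (inj₁ (punchOut-injective j≢k (i≢j ∘ sym) e , sym j≡l))
  ... | no j≢k  | no j≢l  = inj₁ (punchOut-injective j≢k j≢l e)

  identify-surjective : ∀ t → ∃ λ k → identify k ≡ t
  identify-surjective t = punchIn j t , identify-punchIn
    where
    identify-punchIn : identify (punchIn j t) ≡ t
    identify-punchIn with j ≟ punchIn j t
    ... | yes j≡ = ⊥-elim (punchInᵢ≢i j t (sym j≡))
    ... | no _   = trans (punchOut-cong j refl) (punchOut-punchIn j)

Link : Fin m → Fin m → Rel (Fin m) 0ℓ
Link a b x y = x ≡ a × y ≡ b

module _ {R : Rel (Fin m) 0ℓ} {a b : Fin m} where

  Labelling-link-joined : EqClosure R a b → Labelling (EqClosure R) c → Labelling (EqClosure (R ∪ Link a b)) c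
  Labelling-link-joined a~b = Labelling-resp (EqClosure-resp (single ∘ inj₁) closed)
    where
    closed : R ∪ Link a b ⇒ EqClosure R
    closed (inj₁ r)            = single r
    closed (inj₂ (refl , refl)) = a~b

  Labelling-link-merge : (L : Labelling (EqClosure R) (suc c)) → label L a ≢ label L b →
                         Labelling (EqClosure (R ∪ Link a b)) c
  Labelling-link-merge L la≢lb = record
    { label = merged ; reflects = reflects′ ; respects = respects′ ; surjective = surjective′ }
    where
    merged = identify (label L a) (label L b) la≢lb ∘ label L
    widen : EqClosure R ⇒ EqClosure (R ∪ Link a b)
    widen = EqClosure.map inj₁
    link : EqClosure (R ∪ Link a b) a b
    link = single (inj₂ (refl , refl))
    reflects′ : ∀ x y → merged x ≡ merged y → EqClosure (R ∪ Link a b) x y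
    reflects′ x y e with identify-kernel (label L a) (label L b) la≢lb (label L x) (label L y) e
    ... | inj₁ lx≡ly = widen (reflects L x y lx≡ly)
    ... | inj₂ (inj₁ (lx≡la , ly≡lb)) =
      widen (reflects L x a lx≡la) ◅◅ link ◅◅ widen (reflects L b y (sym ly≡lb))
    ... | inj₂ (inj₂ (lx≡lb , ly≡la)) =
      widen (reflects L x b lx≡lb) ◅◅ EqClosure.symmetric _ link ◅◅ widen (reflects L a y (sym ly≡la))
    respects′ : ∀ {x y} → EqClosure (R ∪ Link a b) x y → merged x ≡ merged y
    respects′ = EqClosure.gfold isEquivalence merged λ
      { (inj₁ r)             → cong (identify _ _ la≢lb) (respects L (single r))
      ; (inj₂ (refl , refl)) → identify-identifies (label L a) (label L b) la≢lb }
    surjective′ : ∀ t → ∃ λ x → merged x ≡ t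
    surjective′ t with identify-surjective (label L a) (label L b) la≢lb t
    ... | k , e with surjective L k
    ...   | x , refl = x , e

module _ {R : Rel (Fin m) 0ℓ} {a b : Fin m} where

  link-joined-count : EqClosure R a b → Labelling (EqClosure R) c →
                      Labelling (EqClosure (R ∪ Link a b)) c′ → c′ ≡ c
  link-joined-count a~b L L′ = labelling-unique L′ (Labelling-link-joined a~b L)

  link-merge-count : ¬ EqClosure R a b → Labelling (EqClosure R) c →
                     Labelling (EqClosure (R ∪ Link a b)) c′ → c ≡ suc c′
  link-merge-count {c = zero}  a≁b L L′ = ⊥-elim (¬Fin0 (label L a))
  link-merge-count {c = suc c} a≁b L L′ =
    cong suc (labelling-unique (Labelling-link-merge L (a≁b ∘ reflects L a b)) L′)

-- Composing a permutation with a transposition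

module _ {P : ℕ → Set} (P? : ∀ k → Dec (P k)) where

  least : ∃ P → ∃ λ l → P l × (∀ {i} → i < l → ¬ P i)
  least (k , Pk) = search (suc k) (k , n<1+n k , Pk)
    where
    search : ∀ n → (∃ λ k → k < n × P k) → ∃ λ l → P l × (∀ {i} → i < l → ¬ P i)
    search (suc n) (k , k<1+n , Pk) with anyUpTo? P? n
    ... | yes below = search n below
    ... | no none   = k , Pk , λ i<k Pi → none (_ , <-≤-trans i<k (≤-pred k<1+n) , Pi)

module _ {g : Endo m} (g-inj : Injective _≡_ _≡_ g) {a b : Fin m} where

  private
    g′ = g ∘ transpose a b

  orbit-∘-transpose⇒ : Step g′ ⇒ EqClosure (Step g ∪ Link a b)
  orbit-∘-transpose⇒ {x} refl with transposeView a b x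
  ... | at-i          = single (inj₂ (refl , refl)) ◅◅ single (inj₁ (cong g (sym (transpose-matchˡ a b))))
  ... | at-j _        = bwd (inj₂ (refl , refl)) ◅ single (inj₁ (cong g (sym (transpose-matchʳ a b))))
  ... | apart x≢a x≢b = single (inj₁ (cong g (sym (transpose-other x≢a x≢b))))

  module _ (a≁b : ¬ Orbit g a b) where

    transpose-links : Orbit g′ a b
    transpose-links with iter-period g-inj b
    ... | p , period = subst (Orbit g′ a) period (reach p)
      where
      reach : ∀ k → Orbit g′ a (iter g (suc k) b)
      reach zero    = single (cong g (transpose-matchˡ a b))
      reach (suc k) with iter g (suc k) b ≟ b
      ... | yes gᵏb≡b = subst (Orbit g′ a) (cong g (sym gᵏb≡b)) (reach zero)
      ... | no gᵏb≢b = reach k ◅◅ single (cong g (transpose-other gᵏb≢a gᵏb≢b))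
        where
        gᵏb≢a : iter g (suc k) b ≢ a
        gᵏb≢a e = a≁b (EqClosure.symmetric _ (reaches⇒orbit (suc k , e)))

    orbit-∘-transpose⇐ : Step g ∪ Link a b ⇒ Orbit g′
    orbit-∘-transpose⇐ (inj₂ (refl , refl)) = transpose-links
    orbit-∘-transpose⇐ {x} (inj₁ refl) with transposeView a b x
    ... | at-i          = transpose-links ◅◅ single (cong g (transpose-matchʳ a b))
    ... | at-j _        = EqClosure.symmetric _ transpose-links ◅◅ single (cong g (transpose-matchˡ a b))
    ... | apart x≢a x≢b = single (cong g (transpose-other x≢a x≢b))

    Labelling-∘-transpose-merge : Labelling (Orbit g) (suc c) → Labelling (Orbit g′) c
    Labelling-∘-transpose-merge L =
      Labelling-resp (EqClosure-resp orbit-∘-transpose⇐ orbit-∘-transpose⇒)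
                     (Labelling-link-merge L (a≁b ∘ reflects L a b))

    orbits-∘-transpose-merge : Labelling (Orbit g) c → Labelling (Orbit g′) c′ → c ≡ suc c′
    orbits-∘-transpose-merge {c = zero}  L L′ = ⊥-elim (¬Fin0 (label L a))
    orbits-∘-transpose-merge {c = suc c} L L′ = cong suc (labelling-unique (Labelling-∘-transpose-merge L) L′)

  -- For the least k with g^(k+1) a = b, the segment g a, …, g^(k+1) a contains b,
  -- is closed under g ∘ (a b), and misses a.
  orbit-∘-transpose-split : a ≢ b → Orbit g a b → ¬ Orbit g′ a b
  orbit-∘-transpose-split a≢b a~b a~′b
    with least (λ k → iter g k a ≟ b) (orbit⇒reaches g-inj a~b)
  ... | zero  , a≡b     , _       = a≢b a≡b
  ... | suc k , gᵏ⁺¹a≡b , minimal = a∉segment (reached (orbit⇒reaches g′-injective (EqClosure.symmetric _ a~′b)))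
    where
    Segment : Fin m → Set
    Segment z = ∃ λ i → i ≤ k × iter g (suc i) a ≡ z

    a∉segment : ¬ Segment a
    a∉segment (i , i≤k , gⁱ⁺¹a≡a) = minimal (s≤s (m∸n≤m k i)) (begin
      iter g (k ∸ i) a                  ≡⟨ cong (iter g (k ∸ i)) gⁱ⁺¹a≡a ⟨
      iter g (k ∸ i) (iter g (suc i) a) ≡⟨ iter-+ (k ∸ i) (suc i) a ⟨
      iter g (k ∸ i + suc i) a          ≡⟨ cong (λ l → iter g l a) (trans (+-suc (k ∸ i) i) (cong suc (m∸n+n≡m i≤k))) ⟩
      iter g (suc k) a                  ≡⟨ gᵏ⁺¹a≡b ⟩
      b                                 ∎)
      where open ≡-Reasoning

    b∈segment : Segment b
    b∈segment = k , ≤-refl , gᵏ⁺¹a≡b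

    segment-closed : ∀ {z} → Segment z → Segment (g′ z)
    segment-closed (i , i≤k , refl) with m≤n⇒m<n∨m≡n i≤k
    ... | inj₁ i<k  = suc i , i<k ,
                      cong g (sym (transpose-other (λ e → a∉segment (i , i≤k , e)) (minimal (s≤s i<k))))
    ... | inj₂ refl = zero , z≤n , cong g (sym (trans (cong (transpose a b) gᵏ⁺¹a≡b) (transpose-matchʳ a b)))

    segment-iter : ∀ l {z} → Segment z → Segment (iter g′ l z)
    segment-iter zero    s = s
    segment-iter (suc l) s = segment-closed (segment-iter l s)

    reached : ∀ {z} → Reaches g′ b z → Segment z
    reached (l , refl) = segment-iter l b∈segment

    g′-injective : Injective _≡_ _≡_ g′
    g′-injective e = transpose-injective a b (g-inj e)

orbits-∘-transpose-split : ∀ {g : Endo m} → Injective _≡_ _≡_ g → ∀ {a b} → a ≢ b → Orbit g a b →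
                           Labelling (Orbit g) c → Labelling (Orbit (g ∘ transpose a b)) c′ → c′ ≡ suc c
orbits-∘-transpose-split {g = g} g-inj {a} {b} a≢b a~b L L′ =
  orbits-∘-transpose-merge (λ e → transpose-injective a b (g-inj e)) (orbit-∘-transpose-split g-inj a≢b a~b)
                           L′ (Labelling-resp (Orbit-resp-≗ undo , Orbit-resp-≗ (sym ∘ undo)) L)
  where
  undo : g ≗ g ∘ transpose a b ∘ transpose a b
  undo x = cong g (sym (transpose-involutive a b x))

-- Euler's inequality for a permutation and an involution

Components : Endo m → Endo m → Rel (Fin m) 0ℓ
Components σ h = EqClosure (Step σ ∪ Step h)

Components-resp-≗ : ∀ {σ h h′ : Endo m} → h ≗ h′ → Components σ h ⇒ Components σ h′
Components-resp-≗ h≗h′ = EqClosure.map λ where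
  (inj₁ σx≡y)       → inj₁ σx≡y
  {x} (inj₂ hx≡y) → inj₂ (trans (sym (h≗h′ x)) hx≡y)

Orbit-∘⊆Components : ∀ {σ h : Endo m} → Orbit (σ ∘ h) ⇒ Components σ h
Orbit-∘⊆Components = (λ where refl → single (inj₂ refl) ◅◅ single (inj₁ refl)) ⋆

euler-step : ∀ n m {c₂ c₃ c₄ c₂′ c₃′ c₄′} → c₂ ≡ suc c₂′ →
             (c₃′ ≡ suc c₃ × c₄′ ≡ c₄) ⊎ (c₃ ≡ suc c₃′ × c₄ ≤ suc c₄′) →
             n + c₂ + c₃ ≤ m + 2 * c₄ → n + c₂′ + c₃′ ≤ m + 2 * c₄′
euler-step n m {c₃ = c₃} {c₄} {c₂′} refl (inj₁ (refl , refl)) bound =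
  subst (_≤ m + 2 * c₄) (shuffle n c₂′ c₃) bound
  where
  shuffle : ∀ n a b → n + suc a + b ≡ n + a + suc b
  shuffle = solve-∀
euler-step n m {c₂′ = c₂′} {c₃′} {c₄′} refl (inj₂ (refl , c₄≤1+c₄′)) bound =
  ≤-pred (≤-pred (subst₂ _≤_ (lhs n c₂′ c₃′) (rhs m c₄′) (≤-trans bound (+-monoʳ-≤ m (*-monoʳ-≤ 2 c₄≤1+c₄′)))))
  where
  lhs : ∀ n a b → n + suc a + suc b ≡ 2 + (n + a + b)
  lhs = solve-∀
  rhs : ∀ m c → m + 2 * suc c ≡ 2 + (m + 2 * c)
  rhs = solve-∀

module Detach {m} (h : Endo m) (h-invol : Involutive _≡_ h) (a : Fin m) where

  detach : Endo m
  detach = h ∘ transpose a (h a)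

  detach-fixes-a : detach a ≡ a
  detach-fixes-a = trans (cong h (transpose-matchˡ a (h a))) (h-invol a)

  detach-fixes-partner : detach (h a) ≡ h a
  detach-fixes-partner = cong h (transpose-matchʳ a (h a))

  detach-other : ∀ {x} → x ≢ a → x ≢ h a → detach x ≡ h x
  detach-other x≢a x≢ha = cong h (transpose-other x≢a x≢ha)

  detach-involutive : Involutive _≡_ detach
  detach-involutive x with transposeView a (h a) x
  ... | at-i          = trans (cong detach detach-fixes-a) detach-fixes-a
  ... | at-j _        = trans (cong detach detach-fixes-partner) detach-fixes-partner
  ... | apart x≢a x≢ha = begin
    detach (detach x) ≡⟨ cong detach (detach-other x≢a x≢ha) ⟩
    detach (h x)      ≡⟨ detach-other (x≢ha ∘ hx≡a⇒x≡ha) (x≢a ∘ involutive⇒injective h-invol) ⟩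
    h (h x)           ≡⟨ h-invol x ⟩
    x                 ∎
    where
    open ≡-Reasoning
    hx≡a⇒x≡ha : h x ≡ a → x ≡ h a
    hx≡a⇒x≡ha hx≡a = trans (sym (h-invol x)) (cong h hx≡a)

  reattach : detach ∘ transpose a (h a) ≗ h
  reattach x = cong h (transpose-involutive a (h a) x)

module Euler {σ : Endo m} (σ-inj : Injective _≡_ _≡_ σ) {nσ : ℕ} (vertices : Labelling (Orbit σ) nσ) where

  EulerBound : Endo m → Set
  EulerBound h = ∀ {c₂ c₃ c₄} → Labelling (Orbit h) c₂ → Labelling (Orbit (σ ∘ h)) c₃ →
                 Labelling (Components σ h) c₄ → nσ + c₂ + c₃ ≤ m + 2 * c₄

  HasComponents : Endo m → Set
  HasComponents h = ∃ (Labelling (Components σ h))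

  module _ {h : Endo m} (h-inj : Injective _≡_ _≡_ h) {a b}
           (ha≡a : h a ≡ a) (hb≡b : h b ≡ b) (a≢b : a ≢ b) where

    private
      h′ = h ∘ transpose a b

      a≁b : ¬ Orbit h a b
      a≁b a~b = a≢b (sym (orbit-of-fixed h-inj ha≡a a~b))

      σh-inj : Injective _≡_ _≡_ (σ ∘ h)
      σh-inj e = h-inj (σ-inj e)

    components-link : Components σ h′ ⇔ EqClosure ((Step σ ∪ Step h) ∪ Link a b)
    components-link = EqClosure-resp to from
      where
      to : Step σ ∪ Step h′ ⇒ EqClosure ((Step σ ∪ Step h) ∪ Link a b)
      to (inj₁ σx≡y)       = single (inj₁ (inj₁ σx≡y))
      to {x} (inj₂ refl) with transposeView a b x
      ... | at-i          = single (inj₂ (refl , trans (cong h (transpose-matchˡ a b)) hb≡b))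
      ... | at-j _        = bwd (inj₂ (trans (cong h (transpose-matchʳ a b)) ha≡a , refl)) ◅ ε
      ... | apart x≢a x≢b = single (inj₁ (inj₂ (cong h (sym (transpose-other x≢a x≢b)))))
      from : (Step σ ∪ Step h) ∪ Link a b ⇒ Components σ h′
      from (inj₁ (inj₁ σx≡y)) = single (inj₁ σx≡y)
      from {x} (inj₁ (inj₂ refl)) with transposeView a b x
      ... | at-i          = subst (Components σ h′ a) (sym ha≡a) ε
      ... | at-j _        = subst (Components σ h′ b) (sym hb≡b) ε
      ... | apart x≢a x≢b = single (inj₂ (cong h (transpose-other x≢a x≢b)))
      from (inj₂ (refl , refl)) = single (inj₂ (trans (cong h (transpose-matchˡ a b)) hb≡b))

    HasComponents-link : HasComponents h → HasComponents h′
    HasComponents-link (c₄ , C) with label C a ≟ label C b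
    ... | yes la≡lb = c₄ , Labelling-resp (swap components-link) (Labelling-link-joined (reflects C a b la≡lb) C)
    HasComponents-link (zero , C)   | no _     = ⊥-elim (¬Fin0 (label C a))
    HasComponents-link (suc c₄ , C) | no la≢lb = c₄ , Labelling-resp (swap components-link) (Labelling-link-merge C la≢lb)

    components-link-≤ : Labelling (Components σ h) c → Labelling (Components σ h′) c′ → c ≤ suc c′
    components-link-≤ C C′ with label C a ≟ label C b
    ... | yes la≡lb = ≤-trans (≤-reflexive (sym (link-joined-count (reflects C a b la≡lb) C C′-link))) (n≤1+n _)
      where C′-link = Labelling-resp components-link C′
    ... | no la≢lb  = ≤-reflexive (link-merge-count (la≢lb ∘ respects C) C (Labelling-resp components-link C′))

    link-effect : Labelling (Orbit (σ ∘ h)) c → Labelling (Components σ h) c′ →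
                  ∀ {c₃′ c₄′} → Labelling (Orbit (σ ∘ h′)) c₃′ → Labelling (Components σ h′) c₄′ →
                  (c₃′ ≡ suc c × c₄′ ≡ c′) ⊎ (c ≡ suc c₃′ × c′ ≤ suc c₄′)
    link-effect F C F′ C′ with orbit? σh-inj a b
    ... | yes a~ᶠb = inj₁ ( orbits-∘-transpose-split σh-inj a≢b a~ᶠb F F′
                          , link-joined-count (Orbit-∘⊆Components a~ᶠb) C (Labelling-resp components-link C′))
    ... | no a≁ᶠb  = inj₂ (orbits-∘-transpose-merge σh-inj a≁ᶠb F F′ , components-link-≤ C C′)

    EulerBound-link : HasComponents h → EulerBound h → EulerBound h′
    EulerBound-link (c₄ , C) bound O′ F′ C′ with orbitLabelling h-inj | orbitLabelling σh-inj
    ... | c₂ , O | c₃ , F =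
      euler-step nσ m (orbits-∘-transpose-merge h-inj a≁b O O′) (link-effect F C F′ C′) (bound O F C)

  vertex-components : Orbit σ ⇔ Components σ id
  vertex-components = EqClosure.map inj₁ , (λ where (inj₁ σx≡y) → single σx≡y ; (inj₂ refl) → ε) ⋆

  HasComponents-id : HasComponents id
  HasComponents-id = nσ , Labelling-resp vertex-components vertices

  EulerBound-id : EulerBound id
  EulerBound-id O F C
    rewrite labelling-unique O id-orbits | labelling-unique F vertices
          | labelling-unique C (Labelling-resp vertex-components vertices)
    = ≤-reflexive (equation m nσ)
    where
    equation : ∀ m n → n + m + n ≡ m + 2 * n
    equation = solve-∀

  module _ {h h′ : Endo m} (h≗h′ : h ≗ h′) where

    private
      orbits : Orbit h ⇔ Orbit h′
      orbits = Orbit-resp-≗ h≗h′ , Orbit-resp-≗ (sym ∘ h≗h′)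
      faces : Orbit (σ ∘ h) ⇔ Orbit (σ ∘ h′)
      faces = Orbit-resp-≗ (cong σ ∘ h≗h′) , Orbit-resp-≗ (cong σ ∘ sym ∘ h≗h′)
      components : Components σ h ⇔ Components σ h′
      components = Components-resp-≗ h≗h′ , Components-resp-≗ (sym ∘ h≗h′)

    HasComponents-resp-≗ : HasComponents h → HasComponents h′
    HasComponents-resp-≗ (c₄ , C) = c₄ , Labelling-resp components C

    EulerBound-resp-≗ : EulerBound h → EulerBound h′
    EulerBound-resp-≗ bound O F C =
      bound (Labelling-resp (swap orbits) O) (Labelling-resp (swap faces) F) (Labelling-resp (swap components) C)

  -- Components σ h is not decided, so a labelling of it is carried through the induction.
  Invariant : Endo m → Set
  Invariant h = HasComponents h × EulerBound h

  Invariant-reattach : ∀ {h} (h-invol : Involutive _≡_ h) {a} → a ≢ h a →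
                       Invariant (Detach.detach h h-invol a) → Invariant h
  Invariant-reattach {h} h-invol {a} a≢ha (components₀ , bound₀) =
    HasComponents-resp-≗ reattach (HasComponents-link h₀-inj fixes-a fixes-partner a≢ha components₀) ,
    EulerBound-resp-≗ reattach (EulerBound-link h₀-inj fixes-a fixes-partner a≢ha components₀ bound₀)
    where
    open Detach h h-invol a renaming (detach-fixes-a to fixes-a; detach-fixes-partner to fixes-partner)
    h₀-inj = involutive⇒injective detach-involutive

  involution-invariant-within : ∀ (L : List (Fin m)) {h} → Involutive _≡_ h →
                                (∀ x → h x ≢ x → x ∈ L) → Invariant h
  involution-invariant-within [] {h} h-invol moved =
    HasComponents-resp-≗ id≗h HasComponents-id , EulerBound-resp-≗ id≗h EulerBound-id
    where
    id≗h : id ≗ h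
    id≗h x with h x ≟ x
    ... | yes hx≡x = sym hx≡x
    ... | no hx≢x with moved x hx≢x
    ...   | ()
  involution-invariant-within (a ∷ L) {h} h-invol moved with h a ≟ a
  ... | yes ha≡a = involution-invariant-within L h-invol moved-in-L
    where
    moved-in-L : ∀ x → h x ≢ x → x ∈ L
    moved-in-L x hx≢x with moved x hx≢x
    ... | here refl = ⊥-elim (hx≢x ha≡a)
    ... | there x∈L = x∈L
  ... | no ha≢a = Invariant-reattach h-invol (ha≢a ∘ sym)
                    (involution-invariant-within L (Detach.detach-involutive h h-invol a) moved-in-L)
    where
    open Detach h h-invol a
    moved-in-L : ∀ x → detach x ≢ x → x ∈ L
    moved-in-L x h₀x≢x with transposeView a (h a) x
    ... | at-i           = ⊥-elim (h₀x≢x detach-fixes-a)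
    ... | at-j _         = ⊥-elim (h₀x≢x detach-fixes-partner)
    ... | apart x≢a x≢ha with moved x (h₀x≢x ∘ trans (detach-other x≢a x≢ha))
    ...   | here x≡a  = ⊥-elim (x≢a x≡a)
    ...   | there x∈L = x∈L

  euler-bound : ∀ {h} → Involutive _≡_ h → EulerBound h
  euler-bound h-invol = proj₂ (involution-invariant-within (allFin m) h-invol (λ x _ → ∈-allFin x))

-- Plane graphs

Labelling-from-orbits : ∀ {g : Endo m} → Injective _≡_ _≡_ g →
                        (lab : Fin m → Fin c) → (∀ i → ∃ λ x → lab x ≡ i) →
                        (∀ x y → (lab x ≡ lab y) Fun.⇔ Reaches g x y) → Labelling (Orbit g) c
Labelling-from-orbits g-inj lab lab-surjective lab-orbits = record
  { label      = lab
  ; reflects   = λ x y e → reaches⇒orbit (Equivalence.to (lab-orbits x y) e)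
  ; respects   = λ x~y → Equivalence.from (lab-orbits _ _) (orbit⇒reaches g-inj x~y)
  ; surjective = lab-surjective }

module Map (G : PlaneGraph) where

  σᴳ : Endo (d G)
  σᴳ = σ G ⟨$⟩ʳ_

  αᴳ : Endo (d G)
  αᴳ = α G ⟨$⟩ʳ_

  σᴳ-injective : Injective _≡_ _≡_ σᴳ
  σᴳ-injective = Injection.injective (↔⇒↣ (σ G))

  φ-injective : Injective _≡_ _≡_ (σᴳ ∘ αᴳ)
  φ-injective e = involutive⇒injective (α-invol G) (σᴳ-injective e)

  vertices : Labelling (Orbit σᴳ) (n G)
  vertices = Labelling-from-orbits σᴳ-injective (vert G) (vert-surj G) (vert-orb G)

  faces : Labelling (Orbit (σᴳ ∘ αᴳ)) (f G)
  faces = Labelling-from-orbits φ-injective (face G) (face-surj G) (face-orb G)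

  same-vertex : ∀ {h a b} → vert G a ≡ vert G b → Components σᴳ h a b
  same-vertex e = EqClosure.map inj₁ (reaches⇒orbit (Equivalence.to (vert-orb G _ _) e))

module Matching (G : PlaneGraph) (T : PerfectMatching G) where
  open Map G

  matched : Fin (n G) → Fin (d G)
  matched v = proj₁ (M-cover T v)

  matched-vert : ∀ v → vert G (matched v) ≡ v
  matched-vert v = proj₁ (proj₂ (M-cover T v))

  matched-in : ∀ v → M T (matched v) ≡ true
  matched-in v = proj₂ (proj₂ (M-cover T v))

  matched-unique : ∀ {v a} → vert G a ≡ v → M T a ≡ true → matched v ≡ a
  matched-unique {v} a-at-v a∈T =
    M-unique T (matched v) _ (trans (matched-vert v) (sym a-at-v)) (matched-in v) a∈T

  mate : Fin (n G) → Fin (n G)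
  mate v = vert G (αᴳ (matched v))

  mate-involutive : ∀ v → mate (mate v) ≡ v
  mate-involutive v = begin
    vert G (αᴳ (matched (mate v))) ≡⟨ cong (vert G ∘ αᴳ) (matched-unique refl (trans (M-edge T _) (matched-in v))) ⟩
    vert G (αᴳ (αᴳ (matched v)))   ≡⟨ cong (vert G) (α-invol G _) ⟩
    vert G (matched v)             ≡⟨ matched-vert v ⟩
    v                              ∎
    where open ≡-Reasoning

  mate-recolours : ((col , _) : ProperColouring G) → ∀ v → col (mate v) ≡ not (col v)
  mate-recolours (col , proper) v = ¬-not λ e → proper (matched v) (trans e (cong col (sym (matched-vert v))))

module Bypass (G : PlaneGraph) (colouring : ProperColouring G) (P Q : PerfectMatching G)
              {h : Endo (d G)} {x y : Fin (d G)}
              (h-off : ∀ {a} → a ≢ x → a ≢ α G ⟨$⟩ʳ x → h a ≡ α G ⟨$⟩ʳ a)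
              (x∈P : M P x ≡ true) (y∈Q : M Q y ≡ true) (y-at-x : vert G y ≡ vert G x) (y≢x : y ≢ x) where
  open Map G
  private
    module P = Matching G P
    module Q = Matching G Q
    col = proj₁ colouring

  Bypassed : Set
  Bypassed = Components σᴳ h x (αᴳ x)

  Linked : Fin (n G) → Fin (n G) → Set
  Linked s t = Components σᴳ h (Q.matched s) (Q.matched t)

  u v : Fin (n G)
  u = vert G x
  v = vert G (αᴳ x)

  τ : Endo (n G)
  τ = P.mate ∘ Q.mate

  τ-injective : Injective _≡_ _≡_ τ
  τ-injective e = involutive⇒injective {g = Q.mate} Q.mate-involutive
                    (involutive⇒injective {g = P.mate} P.mate-involutive e)

  along : ∀ {a} → a ≢ x → a ≢ αᴳ x → Components σᴳ h a (αᴳ a)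
  along a≢x a≢x̄ = single (inj₂ (h-off a≢x a≢x̄))

  Q-avoids : ∀ {a} → M Q a ≡ true → a ≢ x × a ≢ αᴳ x
  Q-avoids a∈Q = (λ where refl → y≢x (M-unique Q y x y-at-x y∈Q a∈Q))
               , (λ where refl → y≢x (M-unique Q y x y-at-x y∈Q (trans (sym (M-edge Q x)) a∈Q)))

  Q-step : ∀ t → Linked t (Q.mate t)
  Q-step t = along (proj₁ avoids) (proj₂ avoids) ◅◅ same-vertex (sym (Q.matched-vert (Q.mate t)))
    where avoids = Q-avoids (Q.matched-in t)

  P-step : ∀ w → w ≢ u → w ≢ v → Linked w (P.mate w)
  P-step w w≢u w≢v =
    same-vertex (trans (Q.matched-vert w) (sym (P.matched-vert w)))
    ◅◅ along (λ e → w≢u (trans (sym (P.matched-vert w)) (cong (vert G) e)))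
             (λ e → w≢v (trans (sym (P.matched-vert w)) (cong (vert G) e)))
    ◅◅ same-vertex (sym (Q.matched-vert (P.mate w)))

  τ-keeps-colour : ∀ k → col (iter τ k u) ≡ col u
  τ-keeps-colour zero    = refl
  τ-keeps-colour (suc k) = begin
    col (P.mate (Q.mate t)) ≡⟨ P.mate-recolours colouring (Q.mate t) ⟩
    not (col (Q.mate t))    ≡⟨ cong not (Q.mate-recolours colouring t) ⟩
    not (not (col t))       ≡⟨ not-involutive (col t) ⟩
    col t                   ≡⟨ τ-keeps-colour k ⟩
    col u                   ∎
    where
    open ≡-Reasoning
    t = iter τ k u

  arrive : ∀ t → Linked u t → Q.mate t ≡ v → Bypassed
  arrive t u~t qt≡v =
    same-vertex (sym (Q.matched-vert u)) ◅◅ u~t ◅◅ Q-step t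
    ◅◅ same-vertex (trans (Q.matched-vert (Q.mate t)) qt≡v)

  -- Alternately follow the Q-edge and the P-edge at the current vertex, starting at u.
  -- Q-edges avoid the edge of x, and so do P-edges at vertices other than u and v; colours
  -- forbid entering u by a Q-edge, and as τ permutes the vertices the walk enters
  -- v = mate_P u by a Q-edge before it returns to u.
  walk : ∀ k → Bypassed ⊎ Linked u (iter τ k u)
  walk zero = inj₂ ε
  walk (suc k) with walk k
  ... | inj₁ bypassed = inj₁ bypassed
  ... | inj₂ u~t with Q.mate (iter τ k u) ≟ v
  ...   | yes qt≡v = inj₁ (arrive _ u~t qt≡v)
  ...   | no qt≢v  = inj₂ (u~t ◅◅ Q-step t ◅◅ P-step (Q.mate t) qt≢u qt≢v)
    where
    t = iter τ k u
    qt≢u : Q.mate t ≢ u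
    qt≢u e = not-¬ (sym (τ-keeps-colour k)) (trans (cong col (sym e)) (Q.mate-recolours colouring t))

  bypass : Bypassed
  bypass with iter-period τ-injective u
  ... | p , period with walk p
  ...   | inj₁ bypassed = bypassed
  ...   | inj₂ u~t      = arrive _ u~t (begin
    Q.mate t                  ≡⟨ P.mate-involutive (Q.mate t) ⟨
    P.mate (P.mate (Q.mate t)) ≡⟨ cong P.mate period ⟩
    P.mate u                  ≡⟨ cong (vert G ∘ αᴳ) (P.matched-unique refl x∈P) ⟩
    v                         ∎)
    where
    open ≡-Reasoning
    t = iter τ p u

covered-by-two : ∀ {a b : Fin m} → a ≢ b → (∀ w → w ≡ a ⊎ w ≡ b) → m ≡ 2
covered-by-two {m} {a} {b} a≢b covered = ≤-antisym (injective⇒≤ side-injective) (injective⇒≤ pair-injective)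
  where
  side : Fin m → Fin 2
  side w with covered w
  ... | inj₁ _ = zero
  ... | inj₂ _ = suc zero
  side-injective : Injective _≡_ _≡_ side
  side-injective {w} {w′} e with covered w | covered w′
  ... | inj₁ w≡a | inj₁ w′≡a = trans w≡a (sym w′≡a)
  ... | inj₂ w≡b | inj₂ w′≡b = trans w≡b (sym w′≡b)
  pair : Fin 2 → Fin m
  pair zero    = a
  pair (suc _) = b
  pair-injective : Injective _≡_ _≡_ pair
  pair-injective {zero}        {zero}        _ = refl
  pair-injective {suc zero}    {suc zero}    _ = refl
  pair-injective {zero}        {suc zero}    e = ⊥-elim (a≢b e)
  pair-injective {suc zero}    {zero}        e = ⊥-elim (a≢b (sym e))

no-room : ∀ n f d c₂ → 2 * (n + f) ≡ 4 + d → d ≤ 2 * c₂ → n + c₂ + suc f ≤ d + 2 * 1 → ⊥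
no-room n f d c₂ euler d≤2c₂ bound = m+1+n≰m (2 * c₂) (+-cancelˡ-≤ (4 + d) _ _ (begin
  4 + d + (2 * c₂ + 2)       ≡⟨ cong (_+ (2 * c₂ + 2)) euler ⟨
  2 * (n + f) + (2 * c₂ + 2) ≡⟨ doubled n f c₂ ⟩
  2 * (n + c₂ + suc f)       ≤⟨ *-monoʳ-≤ 2 bound ⟩
  2 * (d + 2 * 1)            ≡⟨ doubled-rhs d ⟩
  4 + d + d                  ≤⟨ +-monoʳ-≤ (4 + d) d≤2c₂ ⟩
  4 + d + 2 * c₂             ∎))
  where
  open ≤-Reasoning
  doubled : ∀ n f c → 2 * (n + f) + (2 * c + 2) ≡ 2 * (n + c + suc f)
  doubled = solve-∀
  doubled-rhs : ∀ d → 2 * (d + 2 * 1) ≡ 4 + d + d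
  doubled-rhs = solve-∀

module Deletion (G : PlaneGraph) (P* : Property* G) (not-single : ¬ SingleEdge G) (x : Fin (d G)) where
  open Map G
  open Detach αᴳ (α-invol G) x renaming (detach to G∖x)

  private
    colouring = proj₁ P*
    elementary = proj₂ P*
    x̄ = αᴳ x

  G∖x-involutive : Involutive _≡_ G∖x
  G∖x-involutive = detach-involutive

  G∖x-injective : Injective _≡_ _≡_ G∖x
  G∖x-injective = involutive⇒injective detach-involutive

  σ∘G∖x-injective : Injective _≡_ _≡_ (σᴳ ∘ G∖x)
  σ∘G∖x-injective e = G∖x-injective (σᴳ-injective e)

  σ-same-vertex : ∀ z → vert G (σᴳ z) ≡ vert G z
  σ-same-vertex z = sym (Equivalence.from (vert-orb G z (σᴳ z)) (1 , refl))

  bypass-at : ∀ z → (∀ {a} → a ≢ z → a ≢ αᴳ z → G∖x a ≡ αᴳ a) → σᴳ z ≢ z → Components σᴳ G∖x z (αᴳ z)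
  bypass-at z off σz≢z = Bypass.bypass G colouring (proj₁ (elementary z)) (proj₁ (elementary (σᴳ z))) off
                                       (proj₂ (elementary z)) (proj₂ (elementary (σᴳ z))) (σ-same-vertex z) σz≢z

  only-edge : σᴳ x ≡ x → σᴳ x̄ ≡ x̄ → SingleEdge G
  only-edge σx≡x σx̄≡x̄ =
    covered-by-two (λ x≡x̄ → α-free G x (sym x≡x̄))
                   (λ w → Star.fold Closed (λ s closed → closed ∘ step s) id (connected G x w) (inj₁ refl))
    where
    Closed : Rel (Fin (d G)) 0ℓ
    Closed a b = a ≡ x ⊎ a ≡ x̄ → b ≡ x ⊎ b ≡ x̄
    step : MapStep (α G) (σ G) ⇒ Closed
    step (viaα _) (inj₁ refl) = inj₂ refl
    step (viaα _) (inj₂ refl) = inj₁ (α-invol G x)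
    step (viaσ _) (inj₁ refl) = inj₁ σx≡x
    step (viaσ _) (inj₂ refl) = inj₂ σx̄≡x̄

  edge-bypassed : Components σᴳ G∖x x x̄
  edge-bypassed with σᴳ x ≟ x | σᴳ x̄ ≟ x̄
  ... | no σx≢x | _         = bypass-at x detach-other σx≢x
  ... | yes _   | no σx̄≢x̄  =
    EqClosure.symmetric _ (subst (Components σᴳ G∖x x̄) (α-invol G x) (bypass-at x̄ off σx̄≢x̄))
    where
    off : ∀ {a} → a ≢ x̄ → a ≢ αᴳ x̄ → G∖x a ≡ αᴳ a
    off a≢x̄ a≢αx̄ = detach-other (λ a≡x → a≢αx̄ (trans a≡x (sym (α-invol G x)))) a≢x̄
  ... | yes σx≡x | yes σx̄≡x̄ = ⊥-elim (not-single (only-edge σx≡x σx̄≡x̄))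

  connected-after-deletion : ∀ a b → Components σᴳ G∖x a b
  connected-after-deletion a b = Star.fold (Components σᴳ G∖x) (λ s a~b → step s ◅◅ a~b) ε (connected G a b)
    where
    step : MapStep (α G) (σ G) ⇒ Components σᴳ G∖x
    step (viaσ _) = single (inj₁ refl)
    step (viaα z) with transposeView x x̄ z
    ... | at-i          = edge-bypassed
    ... | at-j _        = subst (Components σᴳ G∖x x̄) (sym (α-invol G x)) (EqClosure.symmetric _ edge-bypassed)
    ... | apart z≢x z≢x̄ = single (inj₂ (detach-other z≢x z≢x̄))

  faces-after-deletion : face G x ≡ face G x̄ → Labelling (Orbit (σᴳ ∘ G∖x)) c → c ≡ suc (f G)
  faces-after-deletion same-face F =
    orbits-∘-transpose-split φ-injective (λ x≡x̄ → α-free G x (sym x≡x̄)) (reflects faces x x̄ same-face) faces F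

  euler-after-deletion : Labelling (Orbit G∖x) c → Labelling (Orbit (σᴳ ∘ G∖x)) c′ → n G + c + c′ ≤ d G + 2 * 1
  euler-after-deletion O F =
    Euler.euler-bound σᴳ-injective vertices G∖x-involutive O F (Labelling-total connected-after-deletion x)

lemma6p12 : (G : PlaneGraph) → Property* G → ¬ SingleEdge G →
    ∀ x → face G x ≢ face G (α G ⟨$⟩ʳ x)
lemma6p12 G P* not-single x same-face =
  let open Deletion G P* not-single x
      (c₂ , edges) = orbitLabelling G∖x-injective
      (c₃ , faces) = orbitLabelling σ∘G∖x-injective
      bound = euler-after-deletion edges faces
  in no-room (n G) (f G) (d G) c₂ (euler G) (involution-orbits G∖x-involutive edges)
             (subst (λ c → n G + c₂ + c ≤ d G + 2 * 1) (faces-after-deletion same-face faces) bound)
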